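{- For all integers $c,g\ge1$, every graph $G^c(g)$ (constructed as in the context, with any admissible choices) has girth at least $g$.
   Context: For $g\ge2$, a $g$-cycle in a hypergraph is a sequence $(v_1,E_1,\dots,v_g,E_g)$ of distinct vertices $v_i$ and distinct edges $E_i$ with $v_i,v_{i+1}\in E_i$ for $i<g$ and $v_g,v_1\in E_g$; the girth of a hypergraph (or graph) is the least length of a cycle (infinite if none). Fix $g\ge1$. Vertex-ordered graphs $G^c(g)$ are defined recursively in $c$. $G^1(g)$ is $K_2$ (two vertices joined by an edge) with a linear order on its vertices. For $c>1$: take some $G^{c-1}(g)$ with $n$ vertices, and some $n$-uniform hypergraph $H=(V_H,\mathcal{E}_H)$ of girth at least $g$ and chromatic number at least $c+1$, with a fixed linear order on $V_H$. The vertex set of $G^c(g)$ consists of $V_H$ together with, for each $S\in\mathcal{E}_H$, a set $T(S)$ of new vertices containing one vertex $v'$ for each $v\in S$, ordered as in $V_H$. Edges: $vv'$ for each $S\in\mathcal{E}_H$ and $v\in S$; and, for each $S\in\mathcal{E}_H$, the edges of a copy of $G^{c-1}(g)$ placed on $T(S)$ via the order-preserving bijection. There are no edges inside $V_H$. $G^c(g)$ is given an arbitrary linear order of its vertices. -}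

module Defs where

open import Data.Nat as ℕ using (ℕ; zero; suc; _+_; _*_; _≤_; _<_; s≤s)
open import Data.Fin as Fin using (Fin; zero; suc; toℕ; fromℕ<; splitAt; remQuot)
open import Data.Fin.Permutation using (Permutation′; _⟨$⟩ʳ_)
open import Data.Product using (Σ; ∃; _×_; _,_)
open import Data.Sum using (_⊎_; inj₁; inj₂)
open import Data.Empty using (⊥)
open import Relation.Nullary using (¬_; yes; no)
open import Relation.Binary.PropositionalEquality using (_≡_; _≢_)

next : ∀ {l} → Fin (suc l) → Fin (suc l)
next {l} i with toℕ i ℕ.<? l
... | yes p = fromℕ< (s≤s p)
... | no _  = zero

-- Graphs on vertex set Fin N (vertex order = order of Fin N),
-- given by an adjacency relation.

Graph : ℕ → Set₁
Graph N = Fin N → Fin N → Set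

SameEdge : ∀ {N} → Fin N → Fin N → Fin N → Fin N → Set
SameEdge a b c d = (a ≡ c × b ≡ d) ⊎ (a ≡ d × b ≡ c)

GraphCycle : ∀ {N} → Graph N → (l : ℕ) → Set
GraphCycle {N} adj l =
  Σ (Fin (suc l) → Fin N) λ v →
    (∀ i j → v i ≡ v j → i ≡ j) ×
    (∀ i → adj (v i) (v (next i))) ×
    (∀ i j → i ≢ j → ¬ SameEdge (v i) (v (next i)) (v j) (v (next j)))

GraphGirth≥ : ∀ {N} → Graph N → ℕ → Set
GraphGirth≥ adj g = ∀ l → 2 ≤ suc l → suc l < g → ¬ GraphCycle adj l

-- n-uniform hypergraphs with vertex set Fin m (ordered as Fin m).
-- Each edge S is given by the strictly increasing enumeration
-- Fin n → Fin m of its elements; edges are distinct as sets.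

record Hypergraph (n : ℕ) : Set where
  field
    m        : ℕ
    k        : ℕ
    edge     : Fin k → Fin n → Fin m
    increasing : ∀ s i j → i Fin.< j → edge s i Fin.< edge s j
    distinct : ∀ s t → (∀ i → edge s i ≡ edge t i) → s ≡ t

open Hypergraph public

_∈E_ : ∀ {n} {H : Hypergraph n} → Fin (m H) → Fin (k H) → Set
_∈E_ {H = H} x s = ∃ λ j → edge H s j ≡ x

HyperCycle : ∀ {n} → Hypergraph n → (l : ℕ) → Set
HyperCycle H l =
  Σ (Fin (suc l) → Fin (m H)) λ v →
  Σ (Fin (suc l) → Fin (k H)) λ E →
    (∀ i j → v i ≡ v j → i ≡ j) ×
    (∀ i j → E i ≡ E j → i ≡ j) ×
    (∀ i → _∈E_ {H = H} (v i) (E i) × _∈E_ {H = H} (v (next i)) (E i))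

HyperGirth≥ : ∀ {n} → Hypergraph n → ℕ → Set
HyperGirth≥ H g = ∀ l → 2 ≤ suc l → suc l < g → ¬ HyperCycle H l

ProperColouring : ∀ {n} (H : Hypergraph n) {c} → (Fin (m H) → Fin c) → Set
ProperColouring H col =
  ∀ s → ¬ (∀ i j → col (edge H s i) ≡ col (edge H s j))

Chromatic≥1+ : ∀ {n} → Hypergraph n → ℕ → Set
Chromatic≥1+ H c = ∀ (col : Fin (m H) → Fin c) → ¬ ProperColouring H col

K2 : Graph 2
K2 i j = i ≢ j

-- vertices of the new graph: Fin m (= V_H) ⊎ (Fin k × Fin N)
-- where (s , i) is the vertex of T(S_s) corresponding to the i-th
-- vertex of G^{c-1}, i.e. to the i-th smallest element of S_s.
module _ {N : ℕ} (adj : Graph N) (H : Hypergraph N) where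
  private
    Vtx = Fin (m H) ⊎ (Fin (k H) × Fin N)

    A : Vtx → Vtx → Set
    A (inj₁ _)       (inj₁ _)       = ⊥
    A (inj₁ v)       (inj₂ (s , i)) = edge H s i ≡ v
    A (inj₂ (s , i)) (inj₁ v)       = edge H s i ≡ v
    A (inj₂ (s , i)) (inj₂ (t , j)) = s ≡ t × adj i j

    decode : Fin (m H + k H * N) → Vtx
    decode x with splitAt (m H) x
    ... | inj₁ v = inj₁ v
    ... | inj₂ y = inj₂ (remQuot N y)

  construct : Graph (m H + k H * N)
  construct x y = A (decode x) (decode y)

reorder : ∀ {N} → Graph N → Permutation′ N → Graph N
reorder adj π x y = adj (π ⟨$⟩ʳ x) (π ⟨$⟩ʳ y)

-- IsG g c N G : G (on Fin N) is a possible G^c(g), up to the arbitrary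
-- choice of vertex order (modelled by relabelling with any permutation).
data IsG (g : ℕ) : ℕ → (N : ℕ) → Graph N → Set₁ where
  base  : IsG g 1 2 K2
  step  : ∀ {c N adj} → IsG g c N adj →
          (H : Hypergraph N) → HyperGirth≥ H g → Chromatic≥1+ H (suc c) →
          IsG g (suc c) (m H + k H * N) (construct adj H)
  order : ∀ {c N adj} → IsG g c N adj → (π : Permutation′ N) →
          IsG g c N (reorder adj π)

-- A cycle of G^c(g) either stays inside one copy T(S), where it is a cycle
-- of G^{c-1}(g), or it meets V_H. In the second case, since V_H is independent
-- and distinct copies meet only through V_H, the successive V_H-vertices
-- x₀, x₁, … of the cycle and the hyperedges S₀, S₁, … whose copies are crossed
-- between them form a closed walk in H with x_r ≠ x_{r+1} and S_r ≠ S_{r+1};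
-- both inequalities hold because the vertices of the cycle are distinct. Such a
-- walk contains a cycle of H no longer than the original cycle. Hence girth ≥ g
-- passes from G^{c-1}(g) and H to G^c(g); relabelling preserves it, and K₂ has
-- no cycles at all.

module Submission where

open import Defs
open import Data.Nat as ℕ using (ℕ; zero; suc; _+_; _*_; _∸_; _≤_; _<_; s≤s; z≤n; z<s; _%_)
open import Data.Nat.Properties
  using (≤-refl; <-≤-trans; ≤-<-trans; ≤-pred; <⇒≢; ≤∧≮⇒≡; ≮⇒≥; m<n⇒m<1+n; m<1+n⇒m<n∨m≡n;
         +-suc; +-identityʳ; +-comm; +-cancelˡ-≡; +-cancelʳ-≡; +-monoˡ-<; +-mono-<; +-cancelʳ-<; m<m+n; m≤m+n;
         m∸n+n≡m; m≤n+m; <⇒≤; anyUpTo?)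
open import Data.Nat.DivMod using (_mod_; m%n<n; m<n⇒m%n≡m; n%n≡0; m%n%n≡m%n; %-distribˡ-+; [m+n]%n≡m%n)
open import Data.Fin as Fin using (Fin; zero; suc; toℕ; splitAt; join; remQuot; combine)
open import Data.Fin.Properties
  using (any?; <-cmp; <-irrefl; toℕ-injective; toℕ<n; toℕ≤pred[n]; toℕ-fromℕ<; pigeonhole; join-splitAt; combine-remQuot)
open import Data.Fin.Permutation using (Permutation′; _⟨$⟩ʳ_)
open import Data.Product using (∃; ∃₂; _×_; _,_; proj₁; proj₂; uncurry)
open import Data.Sum using (_⊎_; inj₁; inj₂)
open import Data.Sum.Properties using (inj₁-injective)
open import Data.Empty using (⊥; ⊥-elim)
open import Function using (_∘_; Injection)
open import Function.Properties.Inverse using (↔⇒↣)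
open import Relation.Binary using (tri<; tri≈; tri>)
open import Relation.Nullary using (¬_; Dec; yes; no)
open import Relation.Binary.PropositionalEquality

-- Cyclic positions

next-cases : ∀ {l} (i : Fin (suc l)) →
             (toℕ i < l × toℕ (next i) ≡ suc (toℕ i)) ⊎ (toℕ i ≡ l × next i ≡ zero)
next-cases {l} i with toℕ i ℕ.<? l
... | yes i<l = inj₁ (i<l , toℕ-fromℕ< (s≤s i<l))
... | no  i≮l = inj₂ (≤∧≮⇒≡ (toℕ≤pred[n] i) i≮l , refl)

[1+m%n]%n≡[1+m]%n : ∀ m n .{{_ : ℕ.NonZero n}} → suc (m % n) % n ≡ suc m % n
[1+m%n]%n≡[1+m]%n m n = begin
  (1 + m % n) % n          ≡⟨ %-distribˡ-+ 1 (m % n) n ⟩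
  (1 % n + m % n % n) % n  ≡⟨ cong (λ r → (1 % n + r) % n) (m%n%n≡m%n m n) ⟩
  (1 % n + m % n) % n      ≡⟨ %-distribˡ-+ 1 m n ⟨
  (1 + m) % n              ∎
  where open ≡-Reasoning

toℕ-next : ∀ {l} (i : Fin (suc l)) → toℕ (next i) ≡ suc (toℕ i) % suc l
toℕ-next {l} i with next-cases i
... | inj₁ (i<l , eq) = trans eq (sym (m<n⇒m%n≡m (s≤s i<l)))
... | inj₂ (i≡l , eq) = begin
  toℕ (next i)        ≡⟨ cong toℕ eq ⟩
  0                   ≡⟨ n%n≡0 (suc l) ⟨
  suc l % suc l       ≡⟨ cong (λ r → suc r % suc l) i≡l ⟨
  suc (toℕ i) % suc l ∎
  where open ≡-Reasoning

module _ {l : ℕ} where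

  private
    L = suc l

  next-mod : ∀ n → next (n mod L) ≡ suc n mod L
  next-mod n = toℕ-injective (begin
    toℕ (next (n mod L))     ≡⟨ toℕ-next (n mod L) ⟩
    suc (toℕ (n mod L)) % L  ≡⟨ cong (λ r → suc r % L) (toℕ-fromℕ< _) ⟩
    suc (n % L) % L          ≡⟨ [1+m%n]%n≡[1+m]%n n L ⟩
    suc n % L                ≡⟨ toℕ-fromℕ< _ ⟨
    toℕ (suc n mod L)        ∎)
    where open ≡-Reasoning

  toℕ-mod : (i : Fin L) → toℕ i mod L ≡ i
  toℕ-mod i = toℕ-injective (trans (toℕ-fromℕ< _) (m<n⇒m%n≡m (toℕ<n i)))

  mod-periodic : ∀ n → (n + L) mod L ≡ n mod L
  mod-periodic n = toℕ-injective (trans (toℕ-fromℕ< _) (trans ([m+n]%n≡m%n n L) (sym (toℕ-fromℕ< _))))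

  private
    [t+e]%L≢t : ∀ {t e} → t < L → 0 < e → e < L → (t + e) % L ≢ t
    [t+e]%L≢t {t} {e} t<L 0<e e<L eq with t + e ℕ.<? L
    ... | yes t+e<L = <⇒≢ (m<m+n t 0<e) (sym (trans (sym (m<n⇒m%n≡m t+e<L)) eq))
    ... | no  t+e≮L = <⇒≢ e<L (+-cancelˡ-≡ t e L (trans (sym r+L≡t+e) (cong (_+ L) r≡t)))
      where
      r = t + e ∸ L
      r+L≡t+e : r + L ≡ t + e
      r+L≡t+e = m∸n+n≡m (≮⇒≥ t+e≮L)
      r<L : r < L
      r<L = +-cancelʳ-< L r L (subst (_< L + L) (sym r+L≡t+e) (+-mono-< t<L e<L))
      r≡t : r ≡ t
      r≡t = trans (sym (m<n⇒m%n≡m r<L)) (trans (sym ([m+n]%n≡m%n r L)) (trans (cong (_% L) r+L≡t+e) eq))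

  mod-injective-within-period : ∀ n {e} → 0 < e → e < L → n mod L ≢ (n + e) mod L
  mod-injective-within-period n {e} 0<e e<L eq = [t+e]%L≢t (m%n<n n L) 0<e e<L (sym (begin
    n % L                   ≡⟨ toℕ-fromℕ< _ ⟨
    toℕ (n mod L)           ≡⟨ cong toℕ eq ⟩
    toℕ ((n + e) mod L)     ≡⟨ toℕ-fromℕ< _ ⟩
    (n + e) % L             ≡⟨ %-distribˡ-+ n e L ⟩
    (n % L + e % L) % L     ≡⟨ cong (λ r → (n % L + r) % L) (m<n⇒m%n≡m e<L) ⟩
    (n % L + e) % L         ∎))
    where open ≡-Reasoning

  next-invariant⇒constant : ∀ {X : Set} (f : Fin L → X) → (∀ i → f (next i) ≡ f i) → ∀ i → f i ≡ f zero
  next-invariant⇒constant f invariant i = subst (λ j → f j ≡ f zero) (toℕ-mod i) (from-zero (toℕ i))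
    where
    from-zero : ∀ n → f (n mod L) ≡ f zero
    from-zero zero    = refl
    from-zero (suc n) = trans (cong f (sym (next-mod n))) (trans (invariant _) (from-zero n))

-- Graph cycles

map-cycle : ∀ {N M l} {G : Graph N} {G′ : Graph M} (C : GraphCycle G l) (w : Fin (suc l) → Fin M) →
            (∀ i j → w i ≡ w j → proj₁ C i ≡ proj₁ C j) → (∀ i → G′ (w i) (w (next i))) →
            GraphCycle G′ l
map-cycle (v , v-injective , _ , v-edges≢) w reflects w-adjacent =
  w , (λ i j → v-injective i j ∘ reflects i j) , w-adjacent , w-edges≢
  where
  w-edges≢ : ∀ i j → i ≢ j → ¬ SameEdge (w i) (w (next i)) (w j) (w (next j))
  w-edges≢ i j i≢j (inj₁ (p , q)) = v-edges≢ i j i≢j (inj₁ (reflects _ _ p , reflects _ _ q))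
  w-edges≢ i j i≢j (inj₂ (p , q)) = v-edges≢ i j i≢j (inj₂ (reflects _ _ p , reflects _ _ q))

no-2-cycle : ∀ {N} (G : Graph N) → ¬ GraphCycle G 1
no-2-cycle G (_ , _ , _ , edges≢) = edges≢ zero (suc zero) (λ ()) (inj₂ (refl , refl))

no-long-cycles⇒girth≥ : ∀ {N} {G : Graph N} {g} →
                         (∀ l → 3 ≤ suc l → suc l < g → ¬ GraphCycle G l) → GraphGirth≥ G g
no-long-cycles⇒girth≥         _ zero          (s≤s ())
no-long-cycles⇒girth≥ {G = G} _ (suc zero)    _ _ = no-2-cycle G
no-long-cycles⇒girth≥         h (suc (suc l)) _   = h (suc (suc l)) (s≤s (s≤s (s≤s z≤n)))

K2-girth : ∀ g → GraphGirth≥ K2 g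
K2-girth g = no-long-cycles⇒girth≥ {G = K2} λ where
  l 2<1+l _ (v , v-injective , _) →
    let (i , j , i<j , vi≡vj) = pigeonhole 2<1+l v in <⇒≢ i<j (cong toℕ (v-injective i j vi≡vj))

reorder-girth : ∀ {N g} {G : Graph N} (π : Permutation′ N) → GraphGirth≥ G g → GraphGirth≥ (reorder G π) g
reorder-girth {G = G} π girth l 2≤l l<g C@(v , _ , v-adjacent , _) =
  girth l 2≤l l<g
    (map-cycle {G = reorder G π} {G′ = G} C (λ i → π ⟨$⟩ʳ v i) (λ _ _ → Injection.injective (↔⇒↣ π)) v-adjacent)

-- Cycles in hypergraphs from closed walks

edge-injective : ∀ {n} (H : Hypergraph n) s {i j} → edge H s i ≡ edge H s j → i ≡ j
edge-injective H s {i} {j} eq with <-cmp i j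
... | tri< i<j _ _ = ⊥-elim (<-irrefl eq (increasing H s i j i<j))
... | tri≈ _ i≡j _ = i≡j
... | tri> _ _ j<i = ⊥-elim (<-irrefl (sym eq) (increasing H s j i j<i))

HasCycleShorterThan : ∀ {n} → Hypergraph n → ℕ → Set
HasCycleShorterThan H B = ∃ λ l → 2 ≤ suc l × suc l < B × HyperCycle H l

InjectiveBelow : {X : Set} → (ℕ → X) → ℕ → Set
InjectiveBelow f B = ∀ {a b} → a < B → b < B → f a ≡ f b → a ≡ b

module _ {X : Set} {f : ℕ → X} where

  InjectiveBelow-shift : ∀ {i n j} → n + i ≤ j → InjectiveBelow f j → InjectiveBelow (λ q → f (q + i)) n
  InjectiveBelow-shift {i} n+i≤j injective a<n b<n eq =
    +-cancelʳ-≡ i _ _ (injective (shifted a<n) (shifted b<n) eq)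
    where
    shifted : ∀ {a} → a < _ → a + i < _
    shifted a<n = <-≤-trans (+-monoˡ-< i a<n) n+i≤j

  InjectiveBelow-extend : ∀ {j} → InjectiveBelow f j → ¬ (∃ λ i → i < j × f i ≡ f j) →
                          InjectiveBelow f (suc j)
  InjectiveBelow-extend injective new a<1+j b<1+j eq
    with m<1+n⇒m<n∨m≡n a<1+j | m<1+n⇒m<n∨m≡n b<1+j
  ... | inj₁ a<j  | inj₁ b<j  = injective a<j b<j eq
  ... | inj₁ a<j  | inj₂ refl = ⊥-elim (new (_ , a<j , eq))
  ... | inj₂ refl | inj₁ b<j  = ⊥-elim (new (_ , b<j , sym eq))
  ... | inj₂ refl | inj₂ refl = refl

record NonBacktrackingWalk {n} (H : Hypergraph n) : Set where
  field
    vertex     : ℕ → Fin (m H)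
    hyperedge  : ℕ → Fin (k H)
    source∈    : ∀ r → _∈E_ {H = H} (vertex r) (hyperedge r)
    target∈    : ∀ r → _∈E_ {H = H} (vertex (suc r)) (hyperedge r)
    vertex≢    : ∀ r → vertex r ≢ vertex (suc r)
    hyperedge≢ : ∀ r → hyperedge r ≢ hyperedge (suc r)

module _ {n} {H : Hypergraph n} where

  shift : NonBacktrackingWalk H → ℕ → NonBacktrackingWalk H
  shift w i = record
    { vertex     = λ q → vertex (q + i)
    ; hyperedge  = λ q → hyperedge (q + i)
    ; source∈    = λ q → source∈ (q + i)
    ; target∈    = λ q → target∈ (q + i)
    ; vertex≢    = λ q → vertex≢ (q + i)
    ; hyperedge≢ = λ q → hyperedge≢ (q + i)
    }
    where open NonBacktrackingWalk w

  closed-segment⇒cycle : (w : NonBacktrackingWalk H) → let open NonBacktrackingWalk w in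
    ∀ l → InjectiveBelow vertex (suc l) → InjectiveBelow hyperedge (suc l) →
    _∈E_ {H = H} (vertex 0) (hyperedge l) → HyperCycle H l
  closed-segment⇒cycle w l vertex-injective hyperedge-injective closing =
    (λ i → vertex (toℕ i)) , (λ i → hyperedge (toℕ i)) ,
    (λ i j eq → toℕ-injective (vertex-injective (toℕ<n i) (toℕ<n j) eq)) ,
    (λ i j eq → toℕ-injective (hyperedge-injective (toℕ<n i) (toℕ<n j) eq)) ,
    (λ i → source∈ (toℕ i) , next∈ i)
    where
    open NonBacktrackingWalk w
    next∈ : ∀ i → _∈E_ {H = H} (vertex (toℕ (next i))) (hyperedge (toℕ i))
    next∈ i with next-cases i
    ... | inj₁ (_ , eq)   =
      subst (λ p → _∈E_ {H = H} (vertex p) (hyperedge (toℕ i))) (sym eq) (target∈ (toℕ i))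
    ... | inj₂ (i≡l , eq) =
      subst₂ (λ p q → _∈E_ {H = H} (vertex p) (hyperedge q)) (cong toℕ (sym eq)) (sym i≡l) closing

module _ {n} {H : Hypergraph n} (w : NonBacktrackingWalk H) where

  open NonBacktrackingWalk w

  private
    ∃-gap : ∀ {i j} → i ≤ j → ∃ λ o → o + i ≡ j
    ∃-gap {i} {j} i≤j = j ∸ i , m∸n+n≡m i≤j

  repeated-vertex⇒cycle : ∀ {i j} → i < j → vertex i ≡ vertex j →
                          InjectiveBelow vertex j → InjectiveBelow hyperedge j → HasCycleShorterThan H (suc j)
  repeated-vertex⇒cycle {i} i<j eq vertex-injective hyperedge-injective with ∃-gap (<⇒≤ i<j)
  ... | zero , refl        = ⊥-elim (<⇒≢ i<j refl)
  ... | suc zero , refl    = ⊥-elim (vertex≢ i eq)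
  ... | suc (suc o) , refl =
    suc o , s≤s (s≤s z≤n) , s≤s (s≤s (s≤s (m≤m+n o i))) ,
    closed-segment⇒cycle (shift w i) (suc o)
      (InjectiveBelow-shift ≤-refl vertex-injective) (InjectiveBelow-shift ≤-refl hyperedge-injective)
      (subst (λ x → _∈E_ {H = H} x (hyperedge (suc o + i))) (sym eq) (target∈ (suc o + i)))

  repeated-hyperedge⇒cycle : ∀ {i j} → i < j → hyperedge i ≡ hyperedge j →
                             InjectiveBelow vertex (suc j) → InjectiveBelow hyperedge j →
                             HasCycleShorterThan H (suc j)
  repeated-hyperedge⇒cycle {i} i<j eq vertex-injective hyperedge-injective with ∃-gap i<j
  ... | zero , refl  = ⊥-elim (hyperedge≢ i eq)
  ... | suc o , refl =
    suc o , s≤s (s≤s z≤n) , s≤s (s≤s (subst (suc o ≤_) (sym (+-suc o i)) (s≤s (m≤m+n o i)))) ,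
    closed-segment⇒cycle (shift w (suc i)) (suc o)
      (InjectiveBelow-shift ≤-refl vertex-injective)
      (InjectiveBelow-extend (InjectiveBelow-shift ≤-refl hyperedge-injective) repeats-only-i)
      (subst (_∈E_ {H = H} (vertex (suc i))) eq (target∈ i))
    where
    repeats-only-i : ¬ (∃ λ a → a < suc o × hyperedge (a + suc i) ≡ hyperedge (suc o + suc i))
    repeats-only-i (a , a<1+o , eq′) =
      <⇒≢ (m≤n+m (suc i) a)
          (hyperedge-injective i<j (+-monoˡ-< (suc i) a<1+o) (trans eq (sym eq′)))

  prefix-injective⊎cycle : ∀ j → (InjectiveBelow vertex j × InjectiveBelow hyperedge j) ⊎
                                 HasCycleShorterThan H j
  prefix-injective⊎cycle zero = inj₁ ((λ ()) , (λ ()))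
  prefix-injective⊎cycle (suc j) with prefix-injective⊎cycle j
  ... | inj₂ (l , 2≤1+l , 1+l<j , C) = inj₂ (l , 2≤1+l , m<n⇒m<1+n 1+l<j , C)
  ... | inj₁ (vertex-injective , hyperedge-injective)
    with anyUpTo? (λ i → vertex i Fin.≟ vertex j) j
  ...   | yes (i , i<j , eq) = inj₂ (repeated-vertex⇒cycle i<j eq vertex-injective hyperedge-injective)
  ...   | no new-vertex
    with anyUpTo? (λ i → hyperedge i Fin.≟ hyperedge j) j
  ...     | yes (i , i<j , eq) =
    inj₂ (repeated-hyperedge⇒cycle i<j eq (InjectiveBelow-extend vertex-injective new-vertex) hyperedge-injective)
  ...     | no new-hyperedge =
    inj₁ (InjectiveBelow-extend vertex-injective new-vertex ,
          InjectiveBelow-extend hyperedge-injective new-hyperedge)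

  repeated-vertex-below⇒cycle : ∀ B → ¬ InjectiveBelow vertex B → HasCycleShorterThan H B
  repeated-vertex-below⇒cycle B not-injective with prefix-injective⊎cycle B
  ... | inj₁ (vertex-injective , _) = ⊥-elim (not-injective vertex-injective)
  ... | inj₂ C                       = C

-- The construction

module Construction {N : ℕ} (G : Graph N) (H : Hypergraph N) where

  -- Defs keeps the vertex decoding behind construct private; it is repeated
  -- here so that adjacency in the construction can be analysed.
  Vertex : Set
  Vertex = Fin (m H) ⊎ (Fin (k H) × Fin N)

  _~_ : Vertex → Vertex → Set
  inj₁ _       ~ inj₁ _       = ⊥
  inj₁ a       ~ inj₂ (s , i) = edge H s i ≡ a
  inj₂ (s , i) ~ inj₁ a       = edge H s i ≡ a
  inj₂ (s , i) ~ inj₂ (t , j) = s ≡ t × G i j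

  decode : Fin (m H + k H * N) → Vertex
  decode x with splitAt (m H) x
  ... | inj₁ a = inj₁ a
  ... | inj₂ y = inj₂ (remQuot N y)

  construct⇒~ : ∀ {x y} → construct G H x y → decode x ~ decode y
  construct⇒~ {x} {y} x~y with splitAt (m H) x | splitAt (m H) y
  ... | inj₁ _ | inj₁ _ = x~y
  ... | inj₁ _ | inj₂ _ = x~y
  ... | inj₂ _ | inj₁ _ = x~y
  ... | inj₂ _ | inj₂ _ = x~y

  glue : Fin (m H) ⊎ Fin (k H * N) → Fin (m H + k H * N)
  glue = join (m H) (k H * N)

  encode : Vertex → Fin (m H + k H * N)
  encode (inj₁ a)       = glue (inj₁ a)
  encode (inj₂ (s , i)) = glue (inj₂ (combine s i))

  encode-decode : ∀ x → encode (decode x) ≡ x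
  encode-decode x with splitAt (m H) x in eq
  ... | inj₁ a = trans (cong glue (sym eq)) (join-splitAt (m H) (k H * N) x)
  ... | inj₂ y = begin
    glue (inj₂ (uncurry combine (remQuot {k H} N y)))  ≡⟨ cong (glue ∘ inj₂) (combine-remQuot {k H} N y) ⟩
    glue (inj₂ y)                                      ≡⟨ cong glue eq ⟨
    glue (splitAt (m H) x)                             ≡⟨ join-splitAt (m H) (k H * N) x ⟩
    x                                                  ∎
    where open ≡-Reasoning

  decode-injective : ∀ {x y} → decode x ≡ decode y → x ≡ y
  decode-injective {x} {y} eq = trans (sym (encode-decode x)) (trans (cong encode eq) (encode-decode y))

  InHypergraph : Vertex → Set
  InHypergraph z = ∃ λ a → z ≡ inj₁ a

  in-hypergraph? : ∀ z → Dec (InHypergraph z)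
  in-hypergraph? (inj₁ a) = yes (a , refl)
  in-hypergraph? (inj₂ _) = no λ ()

  in-copy : ∀ z → ¬ InHypergraph z → ∃ λ t → z ≡ inj₂ t
  in-copy (inj₁ a) ¬hyper = ⊥-elim (¬hyper (a , refl))
  in-copy (inj₂ t) _      = t , refl

  cycle-in-copies : ∀ {l} (C : GraphCycle (construct G H) l) →
                    (∀ i → ∃ λ t → decode (proj₁ C i) ≡ inj₂ t) → GraphCycle G l
  cycle-in-copies {l} C@(v , _ , v-adjacent , _) copy-of =
    map-cycle {G = construct G H} {G′ = G} C (proj₂ ∘ t) reflects (proj₂ ∘ t-adjacent)
    where
    t : Fin (suc l) → Fin (k H) × Fin N
    t i = proj₁ (copy-of i)
    t-adjacent : ∀ i → inj₂ (t i) ~ inj₂ (t (next i))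
    t-adjacent i = subst₂ _~_ (proj₂ (copy-of i)) (proj₂ (copy-of (next i))) (construct⇒~ (v-adjacent i))
    same-copy : ∀ i → proj₁ (t i) ≡ proj₁ (t zero)
    same-copy = next-invariant⇒constant (proj₁ ∘ t) (sym ∘ proj₁ ∘ t-adjacent)
    reflects : ∀ i j → proj₂ (t i) ≡ proj₂ (t j) → v i ≡ v j
    reflects i j eq = decode-injective (begin
      decode (v i)  ≡⟨ proj₂ (copy-of i) ⟩
      inj₂ (t i)    ≡⟨ cong inj₂ (cong₂ _,_ (trans (same-copy i) (sym (same-copy j))) eq) ⟩
      inj₂ (t j)    ≡⟨ proj₂ (copy-of j) ⟨
      decode (v j)  ∎)
      where open ≡-Reasoning

  module ThroughHypergraph {l} (3≤1+l : 3 ≤ suc l)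
    (v : Fin (suc l) → Fin (m H + k H * N)) (v-injective : ∀ i j → v i ≡ v j → i ≡ j)
    (v-adjacent : ∀ i → construct G H (v i) (v (next i)))
    {i₀ a₀} (start : decode (v i₀) ≡ inj₁ a₀) where

    u : ℕ → Vertex
    u n = decode (v (n mod suc l))

    u-adjacent : ∀ n → u n ~ u (suc n)
    u-adjacent n = subst (λ j → u n ~ decode (v j)) (next-mod n) (construct⇒~ (v-adjacent (n mod suc l)))

    u-returns : ∀ p → u (suc p + l) ≡ u p
    u-returns p = trans (cong u (sym (+-suc p l))) (cong (decode ∘ v) (mod-periodic p))

    u-injective-within-period : ∀ n {e} → 0 < e → e < suc l → u n ≢ u (n + e)
    u-injective-within-period n 0<e e<1+l =
      mod-injective-within-period n 0<e e<1+l ∘ v-injective _ _ ∘ decode-injective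

    u≢u[2+n] : ∀ n → u n ≢ u (2 + n)
    u≢u[2+n] n eq = u-injective-within-period n z<s 3≤1+l (trans eq (cong u (+-comm 2 n)))

    leave-copy : ∀ fuel q {s i} → u q ≡ inj₂ (s , i) → InHypergraph (u (q + fuel)) →
                 ∃₂ λ d i′ → d < fuel × u (q + d) ≡ inj₂ (s , i′) × InHypergraph (u (suc (q + d)))
    leave-copy zero q uq (_ , uq+0) with trans (sym uq) (trans (cong u (sym (+-identityʳ q))) uq+0)
    ... | ()
    leave-copy (suc fuel) q {s} {i} uq later with in-hypergraph? (u (suc q))
    ... | yes hyper = 0 , i , z<s , trans (cong u (+-identityʳ q)) uq ,
                      subst (InHypergraph ∘ u ∘ suc) (sym (+-identityʳ q)) hyper
    ... | no ¬hyper with in-copy _ ¬hyper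
    ...   | (s′ , i′) , uq+1
      with leave-copy fuel (suc q) {s} {i′}
             (trans uq+1 (cong (λ s″ → inj₂ (s″ , i′)) (sym (proj₁ (subst₂ _~_ uq uq+1 (u-adjacent q))))))
             (subst (InHypergraph ∘ u) (+-suc q fuel) later)
    ...     | d , i″ , d<fuel , in-copy-s , exit =
      suc d , i″ , s≤s d<fuel , subst (λ p → u p ≡ inj₂ (s , i″)) (sym (+-suc q d)) in-copy-s ,
      subst (InHypergraph ∘ u ∘ suc) (sym (+-suc q d)) exit

    -- An anchor is a position of the walk at a vertex of V_H; a hop is the
    -- excursion from an anchor through a single copy T(S) to the next anchor.
    record Anchor : Set where
      constructor anchor
      field
        position    : ℕ
        label       : Fin (m H)
        at-position : u position ≡ inj₁ label

    record Hop (α : Anchor) : Set where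
      open Anchor α
      field
        copy      : Fin (k H)
        len       : ℕ
        entry     : Fin N
        exit      : Fin N
        target    : Fin (m H)
        entry-at  : u (suc position) ≡ inj₂ (copy , entry)
        exit-at   : u (suc position + len) ≡ inj₂ (copy , exit)
        target-at : u (suc (suc position + len)) ≡ inj₁ target
        len<l     : len < l

      entry-attached : edge H copy entry ≡ label
      entry-attached = subst₂ _~_ at-position entry-at (u-adjacent position)

      exit-attached : edge H copy exit ≡ target
      exit-attached = subst₂ _~_ exit-at target-at (u-adjacent (suc position + len))

      next-anchor : Anchor
      next-anchor = anchor (suc (suc position + len)) target target-at

    hop : ∀ α → Hop α
    hop (anchor p a up) with in-hypergraph? (u (suc p))
    ... | yes (_ , up+1) = ⊥-elim (subst₂ _~_ up up+1 (u-adjacent p))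
    ... | no ¬hyper with in-copy _ ¬hyper
    ...   | (s , i) , up+1 with leave-copy l (suc p) up+1 (a , trans (u-returns p) up)
    ...     | d , i′ , d<l , exit-at , b , target-at = record
      { copy = s ; len = d ; entry = i ; exit = i′ ; target = b
      ; entry-at = up+1 ; exit-at = exit-at ; target-at = target-at ; len<l = d<l }

    hop-never-returns : ∀ p d → d < l → u (suc p) ≡ u (suc p + d) → u p ≡ u (suc (suc p + d)) → ⊥
    hop-never-returns p zero    _   _       p≡p+2 =
      u≢u[2+n] p (subst (λ q → u p ≡ u (2 + q)) (+-identityʳ p) p≡p+2)
    hop-never-returns p (suc d) d<l entries _     =
      u-injective-within-period (suc p) z<s (m<n⇒m<1+n d<l) entries

    hop-target≢label : ∀ α → Anchor.label α ≢ Hop.target (hop α)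
    hop-target≢label α a≡b = hop-never-returns position len len<l
      (trans entry-at (trans (cong (λ i → inj₂ (copy , i)) entry≡exit) (sym exit-at)))
      (trans at-position (trans (cong inj₁ a≡b) (sym target-at)))
      where
      open Anchor α
      open Hop (hop α)
      entry≡exit : entry ≡ exit
      entry≡exit = edge-injective H copy (trans entry-attached (trans a≡b (sym exit-attached)))

    consecutive-copies≢ : ∀ α → Hop.copy (hop α) ≢ Hop.copy (hop (Hop.next-anchor (hop α)))
    consecutive-copies≢ α S≡S′ = u≢u[2+n] (suc position + len) (begin
      u (suc position + len)              ≡⟨ exit-at ⟩
      inj₂ (copy , exit)                  ≡⟨ cong inj₂ (cong₂ _,_ S≡S′ exit≡entry′) ⟩
      inj₂ (copy′ , entry′)               ≡⟨ entry-at′ ⟨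
      u (suc (suc (suc position + len)))  ∎)
      where
      open ≡-Reasoning
      open Anchor α
      open Hop (hop α)
      open Hop (hop next-anchor) using ()
        renaming (copy to copy′; entry to entry′; entry-at to entry-at′; entry-attached to entry-attached′)
      exit≡entry′ : exit ≡ entry′
      exit≡entry′ = edge-injective H copy′
        (trans (cong (λ s → edge H s exit) (sym S≡S′)) (trans exit-attached (sym entry-attached′)))

    anchors : ℕ → Anchor
    anchors zero    = anchor (toℕ i₀) a₀ (trans (cong (decode ∘ v) (toℕ-mod i₀)) start)
    anchors (suc r) = Hop.next-anchor (hop (anchors r))

    walk : NonBacktrackingWalk H
    walk = record
      { vertex     = λ r → Anchor.label (anchors r)
      ; hyperedge  = λ r → Hop.copy (hop (anchors r))
      ; source∈    = λ r → Hop.entry (hop (anchors r)) , Hop.entry-attached (hop (anchors r))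
      ; target∈    = λ r → Hop.exit (hop (anchors r)) , Hop.exit-attached (hop (anchors r))
      ; vertex≢    = λ r → hop-target≢label (anchors r)
      ; hyperedge≢ = λ r → consecutive-copies≢ (anchors r)
      }

    walk-repeats-vertex : ¬ InjectiveBelow (NonBacktrackingWalk.vertex walk) (suc (suc l))
    walk-repeats-vertex injective
      with pigeonhole ≤-refl (λ (r : Fin (suc (suc l))) → Anchor.position (anchors (toℕ r)) mod suc l)
    ... | i , j , i<j , same-position = <⇒≢ i<j (injective (toℕ<n i) (toℕ<n j) (inj₁-injective (begin
      inj₁ (Anchor.label (anchors (toℕ i)))  ≡⟨ Anchor.at-position (anchors (toℕ i)) ⟨
      u (Anchor.position (anchors (toℕ i)))  ≡⟨ cong (decode ∘ v) same-position ⟩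
      u (Anchor.position (anchors (toℕ j)))  ≡⟨ Anchor.at-position (anchors (toℕ j)) ⟩
      inj₁ (Anchor.label (anchors (toℕ j)))  ∎)))
      where open ≡-Reasoning

    short-hypercycle : HasCycleShorterThan H (suc (suc l))
    short-hypercycle = repeated-vertex-below⇒cycle walk (suc (suc l)) walk-repeats-vertex

  construct-girth : ∀ {g} → GraphGirth≥ G g → HyperGirth≥ H g → GraphGirth≥ (construct G H) g
  construct-girth {g} G-girth H-girth = no-long-cycles⇒girth≥ {G = construct G H} no-long-cycle
    where
    no-long-cycle : ∀ l → 3 ≤ suc l → suc l < g → ¬ GraphCycle (construct G H) l
    no-long-cycle l 3≤1+l 1+l<g C@(v , v-injective , v-adjacent , _)
      with any? (λ i → in-hypergraph? (decode (v i)))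
    ... | yes (_ , _ , start) =
      let (l′ , 2≤1+l′ , 1+l′<2+l , C′) = ThroughHypergraph.short-hypercycle 3≤1+l v v-injective v-adjacent start
      in H-girth l′ 2≤1+l′ (≤-<-trans (≤-pred 1+l′<2+l) 1+l<g) C′
    ... | no none = G-girth l (<⇒≤ 3≤1+l) 1+l<g (cycle-in-copies C (λ i → in-copy _ (λ hyper → none (i , hyper))))

girth≥ : ∀ {g c N G} → IsG g c N G → GraphGirth≥ G g
girth≥ base                              = K2-girth _
girth≥ (step {adj = G} G-is H H-girth _) = Construction.construct-girth G H (girth≥ G-is) H-girth
girth≥ (order {adj = G} G-is π)          = reorder-girth {G = G} π (girth≥ G-is)

lemma5 : ∀ (c g : ℕ) → 1 ≤ c → 1 ≤ g → ∀ {N} {G : Graph N} →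
           IsG g c N G → GraphGirth≥ G g
lemma5 _ _ _ _ = girth≥
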